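{- For every residuated lattice $\mathbf{A}$ the following are equivalent: (i) $\mathbf{A}$ satisfies $(\mathsf{1}\wedge(x\backslash\mathsf{1}))\vee(\mathsf{1}\wedge x)\approx\mathsf{1}$ (left preconicity); (ii) $\mathbf{A}$ satisfies $\mathsf{1}\wedge(x\vee y)\approx(\mathsf{1}\wedge x)\vee(\mathsf{1}\wedge y)$ and $(x\backslash\mathsf{1})\vee x\geq\mathsf{1}$; (iii) the pointed lattice reduct $\langle A;\wedge,\vee,\mathsf{1}\rangle$ of $\mathbf{A}$ is semiconic and $\mathbf{A}$ satisfies $(x\backslash\mathsf{1})\vee x\geq\mathsf{1}$.
   Context: A residuated lattice is an algebra $\langle A; \wedge, \vee, \cdot, \mathsf{1}, \backslash, / \rangle$ such that $\langle A;\wedge,\vee\rangle$ is a lattice, $\langle A;\cdot,\mathsf{1}\rangle$ is a monoid, and $x \leq z/y \iff x\cdot y \leq z \iff y \leq x\backslash z$. A pointed lattice (lattice with a constant $\mathsf{1}$) is conic if every element $x$ satisfies $x\leq\mathsf{1}$ or $\mathsf{1}\leq x$, and semiconic if it is isomorphic to a subdirect product of conic pointed lattices. -}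

module Defs where

open import Level using (Level; _⊔_) renaming (suc to lsuc)
open import Data.Product using (Σ; _×_; _,_)
open import Data.Sum using (_⊎_)
open import Relation.Binary.PropositionalEquality using (_≡_)

infix 2 _⇔_
_⇔_ : ∀ {a b} → Set a → Set b → Set (a ⊔ b)
P ⇔ Q = (P → Q) × (Q → P)

record PointedLattice (a : Level) : Set (lsuc a) where
  infixr 7 _∧_
  infixr 6 _∨_
  field
    Carrier : Set a
    _∧_ _∨_ : Carrier → Carrier → Carrier
    𝟏 : Carrier
    ∧-assoc : ∀ x y z → (x ∧ y) ∧ z ≡ x ∧ (y ∧ z)
    ∨-assoc : ∀ x y z → (x ∨ y) ∨ z ≡ x ∨ (y ∨ z)
    ∧-comm : ∀ x y → x ∧ y ≡ y ∧ x
    ∨-comm : ∀ x y → x ∨ y ≡ y ∨ x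
    ∧-absorbs-∨ : ∀ x y → x ∧ (x ∨ y) ≡ x
    ∨-absorbs-∧ : ∀ x y → x ∨ (x ∧ y) ≡ x
  infix 4 _≤_
  _≤_ : Carrier → Carrier → Set a
  x ≤ y = x ∧ y ≡ x

Conic : ∀ {a} → PointedLattice a → Set a
Conic L = ∀ x → (x ≤ 𝟏) ⊎ (𝟏 ≤ x)
  where open PointedLattice L

-- Semiconic: isomorphic to a subdirect product of conic pointed lattices,
-- i.e. there is a family (C i)_{i∈I} of conic pointed lattices and an
-- embedding f : L → ∏ C i (injective homomorphism of pointed lattices)
-- such that every composite  π_i ∘ f  is surjective.
record SubdirectConicRep {a} (L : PointedLattice a) : Set (lsuc a) where
  open PointedLattice L
  field
    Index : Set a
    C : Index → PointedLattice a
    C-conic : ∀ i → Conic (C i)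
    f : Carrier → ∀ i → PointedLattice.Carrier (C i)
    f-∧ : ∀ x y i → f (x ∧ y) i ≡ PointedLattice._∧_ (C i) (f x i) (f y i)
    f-∨ : ∀ x y i → f (x ∨ y) i ≡ PointedLattice._∨_ (C i) (f x i) (f y i)
    f-𝟏 : ∀ i → f 𝟏 i ≡ PointedLattice.𝟏 (C i)
    f-injective : ∀ x y → (∀ i → f x i ≡ f y i) → x ≡ y
    f-subdirect : ∀ i (c : PointedLattice.Carrier (C i)) → Σ Carrier (λ x → f x i ≡ c)

Semiconic : ∀ {a} → PointedLattice a → Set (lsuc a)
Semiconic L = SubdirectConicRep L

record ResiduatedLattice (a : Level) : Set (lsuc a) where
  infixr 7 _∧_
  infixr 6 _∨_
  infixl 8 _·_
  infixr 9 _\\_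
  infixl 9 _/_
  field
    Carrier : Set a
    _∧_ _∨_ _·_ _\\_ _/_ : Carrier → Carrier → Carrier
    𝟏 : Carrier
    ∧-assoc : ∀ x y z → (x ∧ y) ∧ z ≡ x ∧ (y ∧ z)
    ∨-assoc : ∀ x y z → (x ∨ y) ∨ z ≡ x ∨ (y ∨ z)
    ∧-comm : ∀ x y → x ∧ y ≡ y ∧ x
    ∨-comm : ∀ x y → x ∨ y ≡ y ∨ x
    ∧-absorbs-∨ : ∀ x y → x ∧ (x ∨ y) ≡ x
    ∨-absorbs-∧ : ∀ x y → x ∨ (x ∧ y) ≡ x
    ·-assoc : ∀ x y z → (x · y) · z ≡ x · (y · z)
    ·-identityˡ : ∀ x → 𝟏 · x ≡ x
    ·-identityʳ : ∀ x → x · 𝟏 ≡ x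
  infix 4 _≤_
  _≤_ : Carrier → Carrier → Set a
  x ≤ y = x ∧ y ≡ x
  field
    residuation-/ : ∀ x y z → (x ≤ z / y) ⇔ (x · y ≤ z)
    residuation-\\ : ∀ x y z → (x · y ≤ z) ⇔ (y ≤ x \\ z)

  reduct : PointedLattice a
  reduct = record
    { Carrier = Carrier ; _∧_ = _∧_ ; _∨_ = _∨_ ; 𝟏 = 𝟏
    ; ∧-assoc = ∧-assoc ; ∨-assoc = ∨-assoc ; ∧-comm = ∧-comm ; ∨-comm = ∨-comm
    ; ∧-absorbs-∨ = ∧-absorbs-∨ ; ∨-absorbs-∧ = ∨-absorbs-∧ }

module _ {a} (A : ResiduatedLattice a) where
  open ResiduatedLattice A

  LeftPreconic : Set a
  LeftPreconic = ∀ x → (𝟏 ∧ (x \\ 𝟏)) ∨ (𝟏 ∧ x) ≡ 𝟏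

  OneMeetDistrib : Set a
  OneMeetDistrib = ∀ x y → 𝟏 ∧ (x ∨ y) ≡ (𝟏 ∧ x) ∨ (𝟏 ∧ y)

  LeftInvJoinAbove1 : Set a
  LeftInvJoinAbove1 = ∀ x → 𝟏 ≤ (x \\ 𝟏) ∨ x

{-# OPTIONS --safe #-}
module Submission where

-- Left preconicity writes 𝟏 as a ∨ b with a = 𝟏 ∧ (t \\ 𝟏) and b = 𝟏 ∧ t, so every v
-- splits as v · a ∨ v · b.  Bounding the two halves separately shows that 𝟏 distributes
-- over ∨ and ∧ and that 𝟏 ∧ x and 𝟏 ∨ x together determine x, i.e. 𝟏 is a neutral
-- element of the lattice; then x ↦ (𝟏 ∧ x , 𝟏 ∨ x) embeds the reduct subdirectly into
-- the conic pointed lattices ↓𝟏 and ↑𝟏.  Conversely, 𝟏 ∧ (x ∨ y) = (𝟏 ∧ x) ∨ (𝟏 ∧ y)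
-- holds in conic pointed lattices, hence in their subdirect products, and together
-- with 𝟏 ≤ (x \\ 𝟏) ∨ x it is exactly left preconicity.

open import Defs
open import Axiom.UniquenessOfIdentityProofs.WithK using (uip)
open import Data.Bool using (Bool; true; false)
open import Data.Product using (Σ; _×_; _,_; proj₁; proj₂; uncurry)
open import Data.Sum using (_⊎_; inj₁; inj₂)
open import Level using (Lift; lift)
open import Relation.Binary.PropositionalEquality
  using (_≡_; refl; sym; trans; cong; cong₂; isEquivalence; module ≡-Reasoning)
open import Relation.Nullary using (Irrelevant)
import Algebra.Lattice.Bundles as Algebraic
import Algebra.Lattice.Properties.Lattice as AlgebraicProperties
import Relation.Binary.Lattice as Order
import Relation.Binary.Lattice.Properties.JoinSemilattice as JoinProperties
import Relation.Binary.Lattice.Properties.MeetSemilattice as MeetProperties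
import Relation.Binary.Reasoning.PartialOrder as PosetReasoning

module PointedLatticeProperties {a} (L : PointedLattice a) where
  open PointedLattice L

  algebraicLattice : Algebraic.Lattice a a
  algebraicLattice = record
    { isLattice = record
      { isEquivalence = isEquivalence
      ; ∨-comm = ∨-comm ; ∨-assoc = ∨-assoc ; ∨-cong = cong₂ _∨_
      ; ∧-comm = ∧-comm ; ∧-assoc = ∧-assoc ; ∧-cong = cong₂ _∧_
      ; absorptive = ∨-absorbs-∧ , ∧-absorbs-∨
      }
    }

  -- The library orders a lattice by x ≡ x ∧ y; ours is x ∧ y ≡ x, hence the syms.
  orderTheoreticLattice : Order.Lattice a a a
  orderTheoreticLattice = record
    { _≤_ = _≤_
    ; isLattice = record
      { isPartialOrder = record
        { isPreorder = record
          { isEquivalence = isEquivalence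
          ; reflexive = λ x≡y → sym (O.reflexive x≡y)
          ; trans = λ x≤y y≤z → sym (O.trans (sym x≤y) (sym y≤z))
          }
        ; antisym = λ x≤y y≤x → O.antisym (sym x≤y) (sym y≤x)
        }
      ; supremum = λ x y → sym (O.x≤x∨y x y) , sym (O.y≤x∨y x y)
                         , λ z x≤z y≤z → sym (O.∨-least (sym x≤z) (sym y≤z))
      ; infimum = λ x y → sym (O.x∧y≤x x y) , sym (O.x∧y≤y x y)
                        , λ z z≤x z≤y → sym (O.∧-greatest (sym z≤x) (sym z≤y))
      }
    }
    where module O = Order.Lattice
                       (AlgebraicProperties.∨-∧-orderTheoreticLattice algebraicLattice)

  open Order.Lattice orderTheoreticLattice public
    using (poset; x≤x∨y; y≤x∨y; ∨-least; x∧y≤x; x∧y≤y; ∧-greatest)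
    renaming (refl to ≤-refl; reflexive to ≤-reflexive; trans to ≤-trans; antisym to ≤-antisym)
  open JoinProperties (Order.Lattice.joinSemilattice orderTheoreticLattice) public
    using (∨-monotonic)
  open MeetProperties (Order.Lattice.meetSemilattice orderTheoreticLattice) public
    using (∧-monotonic)

  ∧-∨-subdistribˡ : ∀ z x y → (z ∧ x) ∨ (z ∧ y) ≤ z ∧ (x ∨ y)
  ∧-∨-subdistribˡ z x y =
    ∨-least (∧-monotonic ≤-refl (x≤x∨y x y)) (∧-monotonic ≤-refl (y≤x∨y x y))

  ∨-∧-subdistribˡ : ∀ z x y → z ∨ (x ∧ y) ≤ (z ∨ x) ∧ (z ∨ y)
  ∨-∧-subdistribˡ z x y =
    ∧-greatest (∨-monotonic ≤-refl (x∧y≤x x y)) (∨-monotonic ≤-refl (x∧y≤y x y))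

  ∧-distribˡ-∧ : ∀ z x y → z ∧ (x ∧ y) ≡ (z ∧ x) ∧ (z ∧ y)
  ∧-distribˡ-∧ z x y = ≤-antisym
    (∧-greatest (∧-monotonic ≤-refl (x∧y≤x x y)) (∧-monotonic ≤-refl (x∧y≤y x y)))
    (∧-greatest (≤-trans (x∧y≤x _ _) (x∧y≤x z x)) (∧-monotonic (x∧y≤y z x) (x∧y≤y z y)))

  ∨-distribˡ-∨ : ∀ z x y → z ∨ (x ∨ y) ≡ (z ∨ x) ∨ (z ∨ y)
  ∨-distribˡ-∨ z x y = ≤-antisym
    (∨-least (≤-trans (x≤x∨y z x) (x≤x∨y _ _)) (∨-monotonic (y≤x∨y z x) (y≤x∨y z y)))
    (∨-least (∨-monotonic ≤-refl (x≤x∨y x y)) (∨-monotonic ≤-refl (y≤x∨y x y)))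

  conic⇒𝟏∧-distribˡ-∨ : Conic L → ∀ x y → 𝟏 ∧ (x ∨ y) ≡ (𝟏 ∧ x) ∨ (𝟏 ∧ y)
  conic⇒𝟏∧-distribˡ-∨ conic x y =
    ≤-antisym (by-cases (conic x) (conic y)) (∧-∨-subdistribˡ 𝟏 x y)
    where
    by-cases : x ≤ 𝟏 ⊎ 𝟏 ≤ x → y ≤ 𝟏 ⊎ 𝟏 ≤ y → 𝟏 ∧ (x ∨ y) ≤ (𝟏 ∧ x) ∨ (𝟏 ∧ y)
    by-cases (inj₂ 𝟏≤x) _ =
      ≤-trans (x∧y≤x 𝟏 _) (≤-trans (∧-greatest ≤-refl 𝟏≤x) (x≤x∨y _ _))
    by-cases _ (inj₂ 𝟏≤y) =
      ≤-trans (x∧y≤x 𝟏 _) (≤-trans (∧-greatest ≤-refl 𝟏≤y) (y≤x∨y _ _))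
    by-cases (inj₁ x≤𝟏) (inj₁ y≤𝟏) =
      ≤-trans (x∧y≤y 𝟏 _) (∨-monotonic (∧-greatest x≤𝟏 ≤-refl) (∧-greatest y≤𝟏 ≤-refl))

  module Sublattice (P : Carrier → Set a) (P-irrelevant : ∀ {x} → Irrelevant (P x))
                    (P-∧ : ∀ {x y} → P x → P y → P (x ∧ y))
                    (P-∨ : ∀ {x y} → P x → P y → P (x ∨ y))
                    (P-𝟏 : P 𝟏) where

    ≡-by-proj₁ : ∀ {x y} {p : P x} {q : P y} → x ≡ y → (x , p) ≡ (y , q)
    ≡-by-proj₁ refl = cong (_ ,_) (P-irrelevant _ _)

    sublattice : PointedLattice a
    sublattice = record
      { Carrier = Σ Carrier P
      ; _∧_ = λ (x , p) (y , q) → x ∧ y , P-∧ p q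
      ; _∨_ = λ (x , p) (y , q) → x ∨ y , P-∨ p q
      ; 𝟏 = 𝟏 , P-𝟏
      ; ∧-assoc = λ (x , _) (y , _) (z , _) → ≡-by-proj₁ (∧-assoc x y z)
      ; ∨-assoc = λ (x , _) (y , _) (z , _) → ≡-by-proj₁ (∨-assoc x y z)
      ; ∧-comm = λ (x , _) (y , _) → ≡-by-proj₁ (∧-comm x y)
      ; ∨-comm = λ (x , _) (y , _) → ≡-by-proj₁ (∨-comm x y)
      ; ∧-absorbs-∨ = λ (x , _) (y , _) → ≡-by-proj₁ (∧-absorbs-∨ x y)
      ; ∨-absorbs-∧ = λ (x , _) (y , _) → ≡-by-proj₁ (∨-absorbs-∧ x y)
      }

  module ↓𝟏 = Sublattice (_≤ 𝟏) uip (λ _ y≤𝟏 → ≤-trans (x∧y≤y _ _) y≤𝟏) ∨-least ≤-refl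
  module ↑𝟏 = Sublattice (𝟏 ≤_) uip ∧-greatest (λ 𝟏≤x _ → ≤-trans 𝟏≤x (x≤x∨y _ _)) ≤-refl

  ↓𝟏-conic : Conic ↓𝟏.sublattice
  ↓𝟏-conic (_ , x≤𝟏) = inj₁ (↓𝟏.≡-by-proj₁ x≤𝟏)

  ↑𝟏-conic : Conic ↑𝟏.sublattice
  ↑𝟏-conic (_ , 𝟏≤x) = inj₂ (↑𝟏.≡-by-proj₁ 𝟏≤x)

  record NeutralOne : Set a where
    field
      𝟏∧-distribˡ-∨ : ∀ x y → 𝟏 ∧ (x ∨ y) ≡ (𝟏 ∧ x) ∨ (𝟏 ∧ y)
      𝟏∨-distribˡ-∧ : ∀ x y → 𝟏 ∨ (x ∧ y) ≡ (𝟏 ∨ x) ∧ (𝟏 ∨ y)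
      𝟏-cancel : ∀ {x y} → 𝟏 ∧ x ≡ 𝟏 ∧ y → 𝟏 ∨ x ≡ 𝟏 ∨ y → x ≡ y

  neutral⇒semiconic : NeutralOne → Semiconic L
  neutral⇒semiconic neutral = record
    { Index = Lift a Bool ; C = C ; C-conic = C-conic ; f = f
    ; f-∧ = f-∧ ; f-∨ = f-∨ ; f-𝟏 = f-𝟏
    ; f-injective = λ x y fx≡fy →
        𝟏-cancel (cong proj₁ (fx≡fy (lift true))) (cong proj₁ (fx≡fy (lift false)))
    ; f-subdirect = f-subdirect
    }
    where
    open NeutralOne neutral

    C : Lift a Bool → PointedLattice a
    C (lift true) = ↓𝟏.sublattice
    C (lift false) = ↑𝟏.sublattice

    C-conic : ∀ i → Conic (C i)
    C-conic (lift true) = ↓𝟏-conic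
    C-conic (lift false) = ↑𝟏-conic

    f : Carrier → ∀ i → PointedLattice.Carrier (C i)
    f x (lift true) = 𝟏 ∧ x , x∧y≤x 𝟏 x
    f x (lift false) = 𝟏 ∨ x , x≤x∨y 𝟏 x

    f-∧ : ∀ x y i → f (x ∧ y) i ≡ PointedLattice._∧_ (C i) (f x i) (f y i)
    f-∧ x y (lift true) = ↓𝟏.≡-by-proj₁ (∧-distribˡ-∧ 𝟏 x y)
    f-∧ x y (lift false) = ↑𝟏.≡-by-proj₁ (𝟏∨-distribˡ-∧ x y)

    f-∨ : ∀ x y i → f (x ∨ y) i ≡ PointedLattice._∨_ (C i) (f x i) (f y i)
    f-∨ x y (lift true) = ↓𝟏.≡-by-proj₁ (𝟏∧-distribˡ-∨ x y)
    f-∨ x y (lift false) = ↑𝟏.≡-by-proj₁ (∨-distribˡ-∨ 𝟏 x y)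

    f-𝟏 : ∀ i → f 𝟏 i ≡ PointedLattice.𝟏 (C i)
    f-𝟏 (lift true) = ↓𝟏.≡-by-proj₁ ≤-refl
    f-𝟏 (lift false) = ↑𝟏.≡-by-proj₁ (≤-antisym (∨-least ≤-refl ≤-refl) (x≤x∨y 𝟏 𝟏))

    f-subdirect : ∀ i c → Σ Carrier (λ x → f x i ≡ c)
    f-subdirect (lift true) (c , c≤𝟏) = c , ↓𝟏.≡-by-proj₁ (trans (∧-comm 𝟏 c) c≤𝟏)
    f-subdirect (lift false) (c , 𝟏≤c) =
      c , ↑𝟏.≡-by-proj₁ (≤-antisym (∨-least 𝟏≤c ≤-refl) (y≤x∨y 𝟏 c))

semiconic⇒𝟏∧-distribˡ-∨ : ∀ {a} (L : PointedLattice a) → Semiconic L →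
  let open PointedLattice L in ∀ x y → 𝟏 ∧ (x ∨ y) ≡ (𝟏 ∧ x) ∨ (𝟏 ∧ y)
semiconic⇒𝟏∧-distribˡ-∨ L S x y = f-injective _ _ λ i →
  let open PointedLattice (C i) renaming (_∧_ to _∧ᵢ_; _∨_ to _∨ᵢ_; 𝟏 to 𝟏ᵢ) in
  begin
    f (𝟏 ∧ (x ∨ y)) i                 ≡⟨ f-∧ 𝟏 (x ∨ y) i ⟩
    f 𝟏 i ∧ᵢ f (x ∨ y) i              ≡⟨ cong₂ _∧ᵢ_ (f-𝟏 i) (f-∨ x y i) ⟩
    𝟏ᵢ ∧ᵢ (f x i ∨ᵢ f y i)            ≡⟨ PointedLatticeProperties.conic⇒𝟏∧-distribˡ-∨
                                           (C i) (C-conic i) (f x i) (f y i) ⟩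
    (𝟏ᵢ ∧ᵢ f x i) ∨ᵢ (𝟏ᵢ ∧ᵢ f y i)     ≡⟨ cong₂ _∨ᵢ_ (cong (_∧ᵢ f x i) (f-𝟏 i))
                                                   (cong (_∧ᵢ f y i) (f-𝟏 i)) ⟨
    (f 𝟏 i ∧ᵢ f x i) ∨ᵢ (f 𝟏 i ∧ᵢ f y i) ≡⟨ cong₂ _∨ᵢ_ (f-∧ 𝟏 x i) (f-∧ 𝟏 y i) ⟨
    f (𝟏 ∧ x) i ∨ᵢ f (𝟏 ∧ y) i        ≡⟨ f-∨ (𝟏 ∧ x) (𝟏 ∧ y) i ⟨
    f ((𝟏 ∧ x) ∨ (𝟏 ∧ y)) i           ∎
  where
  open PointedLattice L
  open SubdirectConicRep S
  open ≡-Reasoning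

module ResiduatedLatticeProperties {a} (A : ResiduatedLattice a) where
  open ResiduatedLattice A
  open PointedLatticeProperties reduct
  open PosetReasoning poset

  ·≤⇒≤\\ : ∀ {x y z} → x · y ≤ z → y ≤ x \\ z
  ·≤⇒≤\\ {x} {y} {z} = proj₁ (residuation-\\ x y z)

  ≤\\⇒·≤ : ∀ {x y z} → y ≤ x \\ z → x · y ≤ z
  ≤\\⇒·≤ {x} {y} {z} = proj₂ (residuation-\\ x y z)

  ·≤⇒≤/ : ∀ {x y z} → x · y ≤ z → x ≤ z / y
  ·≤⇒≤/ {x} {y} {z} = proj₂ (residuation-/ x y z)

  ≤/⇒·≤ : ∀ {x y z} → x ≤ z / y → x · y ≤ z
  ≤/⇒·≤ {x} {y} {z} = proj₁ (residuation-/ x y z)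

  ·-monoʳ-≤ : ∀ v {x y} → x ≤ y → v · x ≤ v · y
  ·-monoʳ-≤ v x≤y = ≤\\⇒·≤ (≤-trans x≤y (·≤⇒≤\\ ≤-refl))

  ·-monoˡ-≤ : ∀ v {x y} → x ≤ y → x · v ≤ y · v
  ·-monoˡ-≤ v x≤y = ≤/⇒·≤ (≤-trans x≤y (·≤⇒≤/ ≤-refl))

  ·-∨-least : ∀ {v x y c} → v · x ≤ c → v · y ≤ c → v · (x ∨ y) ≤ c
  ·-∨-least vx≤c vy≤c = ≤\\⇒·≤ (∨-least (·≤⇒≤\\ vx≤c) (·≤⇒≤\\ vy≤c))

  ∨-·-least : ∀ {v x y c} → x · v ≤ c → y · v ≤ c → (x ∨ y) · v ≤ c
  ∨-·-least xv≤c yv≤c = ≤/⇒·≤ (∨-least (·≤⇒≤/ xv≤c) (·≤⇒≤/ yv≤c))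

  x·y≤x : ∀ {x y} → y ≤ 𝟏 → x · y ≤ x
  x·y≤x {x} y≤𝟏 = ≤-trans (·-monoʳ-≤ x y≤𝟏) (≤-reflexive (·-identityʳ x))

  y·x≤x : ∀ {x y} → y ≤ 𝟏 → y · x ≤ x
  y·x≤x {x} y≤𝟏 = ≤-trans (·-monoˡ-≤ x y≤𝟏) (≤-reflexive (·-identityˡ x))

  x·[𝟏∧x\\𝟏]≤𝟏∧x : ∀ x → x · (𝟏 ∧ x \\ 𝟏) ≤ 𝟏 ∧ x
  x·[𝟏∧x\\𝟏]≤𝟏∧x x = ∧-greatest
    (≤-trans (·-monoʳ-≤ x (x∧y≤y 𝟏 (x \\ 𝟏))) (≤\\⇒·≤ ≤-refl))
    (x·y≤x (x∧y≤x 𝟏 (x \\ 𝟏)))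

  [𝟏∨x]·[𝟏∧x\\𝟏]≤𝟏 : ∀ x → (𝟏 ∨ x) · (𝟏 ∧ x \\ 𝟏) ≤ 𝟏
  [𝟏∨x]·[𝟏∧x\\𝟏]≤𝟏 x = ∨-·-least
    (≤-trans (≤-reflexive (·-identityˡ _)) (x∧y≤x 𝟏 (x \\ 𝟏)))
    (≤-trans (x·[𝟏∧x\\𝟏]≤𝟏∧x x) (x∧y≤x 𝟏 x))

  [𝟏∨x]·[𝟏∧x]≤x : ∀ x → (𝟏 ∨ x) · (𝟏 ∧ x) ≤ x
  [𝟏∨x]·[𝟏∧x]≤x x = ∨-·-least
    (≤-trans (≤-reflexive (·-identityˡ _)) (x∧y≤y 𝟏 x))
    (x·y≤x (x∧y≤x 𝟏 x))

  preconic⇒invJoin : LeftPreconic A → LeftInvJoinAbove1 A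
  preconic⇒invJoin preconic x = begin
    𝟏                            ≡⟨ preconic x ⟨
    (𝟏 ∧ x \\ 𝟏) ∨ (𝟏 ∧ x)       ≤⟨ ∨-monotonic (x∧y≤y 𝟏 (x \\ 𝟏)) (x∧y≤y 𝟏 x) ⟩
    x \\ 𝟏 ∨ x                   ∎

  distrib∧invJoin⇒preconic : OneMeetDistrib A → LeftInvJoinAbove1 A → LeftPreconic A
  distrib∧invJoin⇒preconic distrib invJoin x = trans (sym (distrib (x \\ 𝟏) x)) (invJoin x)

  module _ (preconic : LeftPreconic A) where

    preconic-cases : ∀ t {v c} → v · (𝟏 ∧ t \\ 𝟏) ≤ c → v · (𝟏 ∧ t) ≤ c → v ≤ c
    preconic-cases t {v} {c} va≤c vb≤c = begin
      v                                  ≡⟨ ·-identityʳ v ⟨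
      v · 𝟏                              ≡⟨ cong (v ·_) (preconic t) ⟨
      v · ((𝟏 ∧ t \\ 𝟏) ∨ (𝟏 ∧ t))       ≤⟨ ·-∨-least va≤c vb≤c ⟩
      c                                  ∎

    𝟏∧[x∨y]≤x∨[𝟏∧y] : ∀ x y → 𝟏 ∧ (x ∨ y) ≤ x ∨ (𝟏 ∧ y)
    𝟏∧[x∨y]≤x∨[𝟏∧y] x y = preconic-cases y
      (begin
        (𝟏 ∧ (x ∨ y)) · (𝟏 ∧ y \\ 𝟏)   ≤⟨ ·-monoˡ-≤ _ (x∧y≤y 𝟏 (x ∨ y)) ⟩
        (x ∨ y) · (𝟏 ∧ y \\ 𝟏)         ≤⟨ ∨-·-least
                                            (≤-trans (x·y≤x (x∧y≤x 𝟏 _)) (x≤x∨y _ _))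
                                            (≤-trans (x·[𝟏∧x\\𝟏]≤𝟏∧x y) (y≤x∨y _ _)) ⟩
        x ∨ (𝟏 ∧ y)                    ∎)
      (≤-trans (y·x≤x (x∧y≤x 𝟏 (x ∨ y))) (y≤x∨y x _))

    x∧[𝟏∨y]≤𝟏∨[x∧y] : ∀ x y → x ∧ (𝟏 ∨ y) ≤ 𝟏 ∨ (x ∧ y)
    x∧[𝟏∨y]≤𝟏∨[x∧y] x y = preconic-cases y
      (begin
        (x ∧ (𝟏 ∨ y)) · (𝟏 ∧ y \\ 𝟏)   ≤⟨ ·-monoˡ-≤ _ (x∧y≤y x (𝟏 ∨ y)) ⟩
        (𝟏 ∨ y) · (𝟏 ∧ y \\ 𝟏)         ≤⟨ [𝟏∨x]·[𝟏∧x\\𝟏]≤𝟏 y ⟩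
        𝟏                              ≤⟨ x≤x∨y 𝟏 (x ∧ y) ⟩
        𝟏 ∨ (x ∧ y)                    ∎)
      (≤-trans
        (∧-greatest (≤-trans (x·y≤x (x∧y≤x 𝟏 y)) (x∧y≤x x _))
                    (≤-trans (·-monoˡ-≤ _ (x∧y≤y x _)) ([𝟏∨x]·[𝟏∧x]≤x y)))
        (y≤x∨y 𝟏 (x ∧ y)))

    𝟏∧-distribˡ-∨ : OneMeetDistrib A
    𝟏∧-distribˡ-∨ x y = ≤-antisym
      (begin
        𝟏 ∧ (x ∨ y)             ≤⟨ ∧-greatest (x∧y≤x 𝟏 _) (𝟏∧[x∨y]≤x∨[𝟏∧y] x y) ⟩
        𝟏 ∧ (x ∨ (𝟏 ∧ y))       ≡⟨ cong (𝟏 ∧_) (∨-comm x (𝟏 ∧ y)) ⟩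
        𝟏 ∧ ((𝟏 ∧ y) ∨ x)       ≤⟨ 𝟏∧[x∨y]≤x∨[𝟏∧y] (𝟏 ∧ y) x ⟩
        (𝟏 ∧ y) ∨ (𝟏 ∧ x)       ≡⟨ ∨-comm (𝟏 ∧ y) (𝟏 ∧ x) ⟩
        (𝟏 ∧ x) ∨ (𝟏 ∧ y)       ∎)
      (∧-∨-subdistribˡ 𝟏 x y)

    𝟏∨-distribˡ-∧ : ∀ x y → 𝟏 ∨ (x ∧ y) ≡ (𝟏 ∨ x) ∧ (𝟏 ∨ y)
    𝟏∨-distribˡ-∧ x y = ≤-antisym
      (∨-∧-subdistribˡ 𝟏 x y)
      (begin
        (𝟏 ∨ x) ∧ (𝟏 ∨ y)       ≡⟨ ∧-comm (𝟏 ∨ x) (𝟏 ∨ y) ⟩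
        (𝟏 ∨ y) ∧ (𝟏 ∨ x)       ≤⟨ x∧[𝟏∨y]≤𝟏∨[x∧y] (𝟏 ∨ y) x ⟩
        𝟏 ∨ ((𝟏 ∨ y) ∧ x)       ≡⟨ cong (𝟏 ∨_) (∧-comm (𝟏 ∨ y) x) ⟩
        𝟏 ∨ (x ∧ (𝟏 ∨ y))       ≤⟨ ∨-least (x≤x∨y 𝟏 _) (x∧[𝟏∨y]≤𝟏∨[x∧y] x y) ⟩
        𝟏 ∨ (x ∧ y)             ∎)

    𝟏-cancel-≤ : ∀ {x y} → 𝟏 ∧ x ≡ 𝟏 ∧ y → 𝟏 ∨ x ≡ 𝟏 ∨ y → x ≤ y
    𝟏-cancel-≤ {x} {y} ∧-eq ∨-eq = preconic-cases x
      (begin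
        x · (𝟏 ∧ x \\ 𝟏)        ≤⟨ x·[𝟏∧x\\𝟏]≤𝟏∧x x ⟩
        𝟏 ∧ x                   ≡⟨ ∧-eq ⟩
        𝟏 ∧ y                   ≤⟨ x∧y≤y 𝟏 y ⟩
        y                       ∎)
      (begin
        x · (𝟏 ∧ x)             ≡⟨ cong (x ·_) ∧-eq ⟩
        x · (𝟏 ∧ y)             ≤⟨ ·-monoˡ-≤ _ (≤-trans (y≤x∨y 𝟏 x) (≤-reflexive ∨-eq)) ⟩
        (𝟏 ∨ y) · (𝟏 ∧ y)       ≤⟨ [𝟏∨x]·[𝟏∧x]≤x y ⟩
        y                       ∎)

    preconic⇒neutralOne : NeutralOne
    preconic⇒neutralOne = record
      { 𝟏∧-distribˡ-∨ = 𝟏∧-distribˡ-∨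
      ; 𝟏∨-distribˡ-∧ = 𝟏∨-distribˡ-∧
      ; 𝟏-cancel = λ ∧-eq ∨-eq →
          ≤-antisym (𝟏-cancel-≤ ∧-eq ∨-eq) (𝟏-cancel-≤ (sym ∧-eq) (sym ∨-eq))
      }

corollary3p29 : ∀ {a} (A : ResiduatedLattice a) →
    (LeftPreconic A ⇔ (OneMeetDistrib A × LeftInvJoinAbove1 A))
    × (LeftPreconic A ⇔ (Semiconic (ResiduatedLattice.reduct A) × LeftInvJoinAbove1 A))
corollary3p29 A =
    ( (λ preconic → 𝟏∧-distribˡ-∨ preconic , preconic⇒invJoin preconic)
    , uncurry distrib∧invJoin⇒preconic )
  , ( (λ preconic → neutral⇒semiconic (preconic⇒neutralOne preconic)
                  , preconic⇒invJoin preconic)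
    , λ (semiconic , invJoin) →
        distrib∧invJoin⇒preconic (semiconic⇒𝟏∧-distribˡ-∨ reduct semiconic) invJoin )
  where
  open ResiduatedLattice A using (reduct)
  open ResiduatedLatticeProperties A
  open PointedLatticeProperties reduct using (neutral⇒semiconic)
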